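{- Fix $m\ge 0$. Let $L^*$ be the set of elements $(r^2+r)g(r^2)$ of $\mathbb{Z}/2[r]$ with $g\in\mathbb{Z}/2[t]$ of degree $\le 4m+3$, and let $K_m=\{f\in L^*: U(f)=f\}$. Then $\dim_{\mathbb{Z}/2}K_m\ge m+1$.
   Context: $\mathbb{Z}/2[r]$, $\mathbb{Z}/2[t]$ are polynomial rings over the field with two elements. Let $F=r(r+1)^3$ and $G=r^3(r+1)$. $\mathbb{Z}/2[r]$ is a free $\mathbb{Z}/2[G]$-module with basis $1,r,r^2,r^3$. Let $U:\mathbb{Z}/2[r]\to\mathbb{Z}/2[r]$ be the map $U\big(\sum_{i=0}^3 g_i(G)r^i\big)=\sum_{i=0}^3 g_i(F)\,U(r^i)$ (for polynomials $g_i$ over $\mathbb{Z}/2$), where $U(1)=1$, $U(r)=r$, $U(r^2)=r^2$, $U(r^3)=r^3+r^2+r$. -}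

module Defs where

open import Data.Bool using (Bool; true; false; _xor_; if_then_else_)
open import Data.List using (List; []; _∷_)
open import Data.Nat using (ℕ; zero; suc; _<_)
open import Data.Fin using (Fin)
open import Data.Product using (Σ; ∃; _×_; _,_)
open import Relation.Binary.PropositionalEquality using (_≡_)

-- Polynomials over ℤ/2 as coefficient lists, lowest degree first.
-- Equality of polynomials is coefficientwise (trailing zeros are irrelevant).
Poly : Set
Poly = List Bool

coeff : Poly → ℕ → Bool
coeff []       _       = false
coeff (a ∷ p)  zero    = a
coeff (a ∷ p)  (suc n) = coeff p n

infix 4 _≈_
_≈_ : Poly → Poly → Set
p ≈ q = ∀ n → coeff p n ≡ coeff q n

infixl 6 _⊕_
_⊕_ : Poly → Poly → Poly
[]      ⊕ q       = q
(a ∷ p) ⊕ []      = a ∷ p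
(a ∷ p) ⊕ (b ∷ q) = (a xor b) ∷ (p ⊕ q)

infixl 7 _⊗_
_⊗_ : Poly → Poly → Poly
[]      ⊗ q = []
(a ∷ p) ⊗ q = (if a then q else []) ⊕ (false ∷ (p ⊗ q))

infixr 9 _∘ₚ_
_∘ₚ_ : Poly → Poly → Poly
[]      ∘ₚ h = []
(a ∷ p) ∘ₚ h = (a ∷ []) ⊕ (h ⊗ (p ∘ₚ h))

zeroP oneP r : Poly
zeroP = []
oneP  = true ∷ []
r     = false ∷ true ∷ []

_^ₚ_ : Poly → ℕ → Poly
p ^ₚ zero  = oneP
p ^ₚ suc n = p ⊗ (p ^ₚ n)

rp1 : Poly
rp1 = true ∷ true ∷ []

F G : Poly
F = r ⊗ (rp1 ^ₚ 3)
G = (r ^ₚ 3) ⊗ rp1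

-- U on the basis 1, r, r^2, r^3
Ubasis : Fin 4 → Poly
Ubasis Fin.zero                          = oneP
Ubasis (Fin.suc Fin.zero)                = r
Ubasis (Fin.suc (Fin.suc Fin.zero))      = r ^ₚ 2
Ubasis (Fin.suc (Fin.suc (Fin.suc Fin.zero))) = (r ^ₚ 3) ⊕ (r ^ₚ 2) ⊕ r

sumP : (n : ℕ) → (Fin n → Poly) → Poly
sumP zero    f = zeroP
sumP (suc n) f = f Fin.zero ⊕ sumP n (λ i → f (Fin.suc i))

-- Graph of U: U f = h  iff  f = Σ g_i(G) r^i  and  h = Σ g_i(F) U(r^i)
-- for some polynomials g_0,…,g_3.  (Since Z/2[r] is free over Z/2[G] with
-- basis 1,r,r^2,r^3, the g_i are unique, so this is the graph of the map U.)
UGraph : Poly → Poly → Set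
UGraph f h = Σ (Fin 4 → Poly) λ g →
  (f ≈ sumP 4 (λ i → (g i ∘ₚ G) ⊗ (r ^ₚ Data.Fin.toℕ i))) ×
  (h ≈ sumP 4 (λ i → (g i ∘ₚ F) ⊗ Ubasis i))

DegLe : Poly → ℕ → Set
DegLe g d = ∀ n → d < n → coeff g n ≡ false

InLstar : ℕ → Poly → Set
InLstar m f = Σ Poly λ g → DegLe g (3 Data.Nat.+ 4 Data.Nat.* m) ×
  (f ≈ ((r ^ₚ 2) ⊕ r) ⊗ (g ∘ₚ (r ^ₚ 2)))

InK : ℕ → Poly → Set
InK m f = InLstar m f × UGraph f f

LinIndep : (k : ℕ) → (Fin k → Poly) → Set
LinIndep k v = (c : Fin k → Bool) →
  sumP k (λ i → if c i then v i else zeroP) ≈ zeroP → ∀ i → c i ≡ false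

DimKAtLeast : ℕ → ℕ → Set
DimKAtLeast m k = Σ (Fin k → Poly) λ v → (∀ i → InK m (v i)) × LinIndep k v

{-# OPTIONS --safe #-}
-- Put s = r² + r.  Over ℤ/2, s⁴ = r⁸ + r⁴ = G s + G² = F s + F², so for H ∈ {G, F} every
-- power sⁿ has coordinates c₀(H), …, c₃(H) in the basis 1, s, s², s³ of ℤ/2[r] over ℤ/2[H],
-- with the same polynomials cᵢ ∈ ℤ/2[t] for both H.  As s = r + r² and
-- s² = G + r² + r³ = F + U(r²) + U(r³), the map U sends c₀(G) + c₁(G) s + c₂(G) s² to
-- c₀(F) + c₁(F) s + c₂(F) s², the same element: a sum of powers of s is fixed by U as soon as
-- its s³-coordinates cancel.  Sums of odd powers s^(2h+1) = s · (s^h)(r²) lie in L*.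
-- The s³-coordinate γ(h) of s^(2h+1) satisfies γ(h+4) = t² γ(h+1) + t⁴ γ(h); hence γ(2i) is a
-- polynomial in t² of degree < 2i and γ(2i+1) one of degree exactly 2i.  Eliminating γ(2j)
-- against γ(1), γ(3), …, γ(2j−1) yields for each j ≤ m a fixed point s^(4j+1) + (lower powers
-- s^(4i+3), i < j) in L*; their degrees 8j+2 are distinct, so they are independent.

module Submission where

open import Defs
open import Data.Nat using (ℕ; zero; suc; _+_; _*_; _≤_; _<_; z≤n; s≤s)
open import Data.Nat.Properties
  using (≤-refl; ≤-reflexive; ≤-trans; n≤1+n; n<1+n; +-monoʳ-≤; *-monoʳ-≤; m≤n⇒m≤1+n; m<n⇒m<1+n; m≤n⇒m<n∨m≡n; m≤n+m; *-suc)
open import Algebra.Bundles using (CommutativeSemigroup; CommutativeRing)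
open import Algebra.Structures using (IsAbelianGroup)
import Algebra.Properties.CommutativeSemigroup as CommSemigroupProperties
open import Data.Bool using (Bool; true; false; _xor_; _∧_; if_then_else_)
open import Data.Bool.Properties using (xor-same; xor-assoc; xor-comm; xor-identityʳ; ∧-comm)
open import Data.Fin using (Fin; zero; suc; toℕ; #_)
open import Data.List using (List; []; _∷_; foldr; map)
open import Data.List.Properties using (map-∘)
open import Data.List.Relation.Unary.All.Properties using () renaming (map⁺ to All-map⁺)
open import Data.List.Relation.Unary.All as All using (All; []; _∷_)
open import Data.Maybe using (nothing)
open import Data.Product using (Σ; _×_; _,_; proj₁; proj₂)
open import Data.Sum using (inj₁; inj₂)
open import Function using (id; case_of_)
open import Relation.Binary.Bundles using (Setoid)
open import Relation.Binary.Structures using (IsEquivalence)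
open import Relation.Binary.PropositionalEquality using (_≡_; refl; sym; trans; cong; cong₂; subst)
import Relation.Binary.Reasoning.Setoid as SetoidReasoning
open import Tactic.RingSolver.Core.AlmostCommutativeRing using (fromCommutativeRing)
import Tactic.RingSolver.NonReflective as RingSolver

-- The ring ℤ/2[r]

-- Wrapping the pointwise equality in a record lets Agda infer both sides from the type.
infix 4 _≋_
record _≋_ (p q : Poly) : Set where
  constructor coeffwise
  field ≋⇒≈ : p ≈ q
open _≋_ public

≋-refl : ∀ {p} → p ≋ p
≋-refl = coeffwise λ _ → refl

≋-sym : ∀ {p q} → p ≋ q → q ≋ p
≋-sym (coeffwise e) = coeffwise λ n → sym (e n)

≋-trans : ∀ {p q w} → p ≋ q → q ≋ w → p ≋ w
≋-trans (coeffwise e) (coeffwise f) = coeffwise λ n → trans (e n) (f n)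

≋-isEquivalence : IsEquivalence _≋_
≋-isEquivalence = record { refl = ≋-refl ; sym = ≋-sym ; trans = ≋-trans }

≋-setoid : Setoid _ _
≋-setoid = record { isEquivalence = ≋-isEquivalence }

open SetoidReasoning ≋-setoid

∷-cong : ∀ {a b p q} → a ≡ b → p ≋ q → a ∷ p ≋ b ∷ q
∷-cong refl (coeffwise e) = coeffwise λ { zero → refl ; (suc n) → e n }

∷-zero : ∀ {p} → p ≋ [] → false ∷ p ≋ []
∷-zero (coeffwise e) = coeffwise λ { zero → refl ; (suc n) → e n }

∷-injective : ∀ {a b p q} → a ∷ p ≋ b ∷ q → a ≡ b × p ≋ q
∷-injective (coeffwise e) = e zero , coeffwise λ n → e (suc n)

∷≋[]⇒ : ∀ {a p} → a ∷ p ≋ [] → a ≡ false × p ≋ []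
∷≋[]⇒ (coeffwise e) = e zero , coeffwise λ n → e (suc n)

coeff-⊕ : ∀ p q n → coeff (p ⊕ q) n ≡ coeff p n xor coeff q n
coeff-⊕ []      q       n       = refl
coeff-⊕ (a ∷ p) []      zero    = sym (xor-identityʳ a)
coeff-⊕ (a ∷ p) []      (suc n) = sym (xor-identityʳ _)
coeff-⊕ (a ∷ p) (b ∷ q) zero    = refl
coeff-⊕ (a ∷ p) (b ∷ q) (suc n) = coeff-⊕ p q n

⊕-cong : ∀ {p p′ q q′} → p ≋ p′ → q ≋ q′ → p ⊕ q ≋ p′ ⊕ q′
⊕-cong {p} {p′} {q} {q′} (coeffwise e) (coeffwise f) = coeffwise λ n →
  trans (coeff-⊕ p q n) (trans (cong₂ _xor_ (e n) (f n)) (sym (coeff-⊕ p′ q′ n)))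

⊕-assoc : ∀ p q w → (p ⊕ q) ⊕ w ≋ p ⊕ (q ⊕ w)
⊕-assoc p q w = coeffwise λ n →
  trans (coeff-⊕ (p ⊕ q) w n) (trans (cong (_xor coeff w n) (coeff-⊕ p q n))
  (trans (xor-assoc (coeff p n) (coeff q n) (coeff w n))
  (sym (trans (coeff-⊕ p (q ⊕ w) n) (cong (coeff p n xor_) (coeff-⊕ q w n))))))

⊕-comm : ∀ p q → p ⊕ q ≋ q ⊕ p
⊕-comm p q = coeffwise λ n →
  trans (coeff-⊕ p q n) (trans (xor-comm (coeff p n) (coeff q n)) (sym (coeff-⊕ q p n)))

⊕-identityʳ : ∀ p → p ⊕ [] ≋ p
⊕-identityʳ p = coeffwise λ n → trans (coeff-⊕ p [] n) (xor-identityʳ (coeff p n))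

⊕-self : ∀ p → p ⊕ p ≋ []
⊕-self p = coeffwise λ n → trans (coeff-⊕ p p n) (xor-same (coeff p n))

⊕-isAbelianGroup : IsAbelianGroup _≋_ _⊕_ [] id
⊕-isAbelianGroup = record
  { isGroup = record
    { isMonoid = record
      { isSemigroup = record
        { isMagma = record { isEquivalence = ≋-isEquivalence ; ∙-cong = ⊕-cong }
        ; assoc = ⊕-assoc }
      ; identity = (λ _ → ≋-refl) , ⊕-identityʳ }
    ; inverse = ⊕-self , ⊕-self
    ; ⁻¹-cong = id }
  ; comm = ⊕-comm }

⊕-commutativeSemigroup : CommutativeSemigroup _ _
⊕-commutativeSemigroup = record
  { isCommutativeSemigroup = IsAbelianGroup.isCommutativeSemigroup ⊕-isAbelianGroup }

open CommSemigroupProperties ⊕-commutativeSemigroup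
  using () renaming (interchange to ⊕-interchange; x∙yz≈y∙xz to ⊕-leftComm)

infixr 7 _·_
_·_ : Bool → Poly → Poly
a · q = if a then q else []

·-cong : ∀ a {p q} → p ≋ q → a · p ≋ a · q
·-cong true  e = e
·-cong false e = ≋-refl

·-xor : ∀ a b w → (a xor b) · w ≋ a · w ⊕ b · w
·-xor true  true  w = ≋-sym (⊕-self w)
·-xor true  false w = ≋-sym (⊕-identityʳ w)
·-xor false b     w = ≋-refl

·-∷ : ∀ a b q → a · (b ∷ q) ≋ (a ∧ b) ∷ a · q
·-∷ true  b q = ≋-refl
·-∷ false b q = ≋-sym (∷-zero ≋-refl)

·-⊗ : ∀ a q w → (a · q) ⊗ w ≋ a · (q ⊗ w)
·-⊗ true  q w = ≋-refl
·-⊗ false q w = ≋-refl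

⊗-zeroʳ : ∀ p → p ⊗ [] ≋ []
⊗-zeroʳ []          = ≋-refl
⊗-zeroʳ (false ∷ p) = ∷-zero (⊗-zeroʳ p)
⊗-zeroʳ (true  ∷ p) = ∷-zero (⊗-zeroʳ p)

⊗-consʳ : ∀ p b q → p ⊗ (b ∷ q) ≋ b · p ⊕ (false ∷ p ⊗ q)
⊗-consʳ []      false q = ≋-sym (∷-zero ≋-refl)
⊗-consʳ []      true  q = ≋-sym (∷-zero ≋-refl)
⊗-consʳ (a ∷ p) b     q = begin
  a · (b ∷ q) ⊕ (false ∷ p ⊗ (b ∷ q))
    ≈⟨ ⊕-cong (·-∷ a b q) (∷-cong refl (⊗-consʳ p b q)) ⟩
  ((a ∧ b) xor false) ∷ (a · q ⊕ (b · p ⊕ (false ∷ p ⊗ q)))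
    ≈⟨ ∷-cong (cong (_xor false) (∧-comm a b)) (⊕-leftComm (a · q) (b · p) _) ⟩
  ((b ∧ a) xor false) ∷ (b · p ⊕ (a · q ⊕ (false ∷ p ⊗ q)))
    ≈⟨ ⊕-cong (·-∷ b a p) ≋-refl ⟨
  b · (a ∷ p) ⊕ (false ∷ (a · q ⊕ (false ∷ p ⊗ q))) ∎

⊗-comm : ∀ p q → p ⊗ q ≋ q ⊗ p
⊗-comm []      q = ≋-sym (⊗-zeroʳ q)
⊗-comm (a ∷ p) q = ≋-trans (⊕-cong ≋-refl (∷-cong refl (⊗-comm p q))) (≋-sym (⊗-consʳ q a p))

⊗-congʳ : ∀ p {q q′} → q ≋ q′ → p ⊗ q ≋ p ⊗ q′
⊗-congʳ []      e = ≋-refl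
⊗-congʳ (a ∷ p) e = ⊕-cong (·-cong a e) (∷-cong refl (⊗-congʳ p e))

⊗-cong : ∀ {p p′ q q′} → p ≋ p′ → q ≋ q′ → p ⊗ q ≋ p′ ⊗ q′
⊗-cong {p} {p′} {q} {q′} e f = begin
  p ⊗ q   ≈⟨ ⊗-congʳ p f ⟩
  p ⊗ q′  ≈⟨ ⊗-comm p q′ ⟩
  q′ ⊗ p  ≈⟨ ⊗-congʳ q′ e ⟩
  q′ ⊗ p′ ≈⟨ ⊗-comm q′ p′ ⟩
  p′ ⊗ q′ ∎

⊗-distribʳ : ∀ p q w → (p ⊕ q) ⊗ w ≋ p ⊗ w ⊕ q ⊗ w
⊗-distribʳ []      q       w = ≋-refl
⊗-distribʳ (a ∷ p) []      w = ≋-sym (⊕-identityʳ _)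
⊗-distribʳ (a ∷ p) (b ∷ q) w = begin
  (a xor b) · w ⊕ (false ∷ (p ⊕ q) ⊗ w)
    ≈⟨ ⊕-cong (·-xor a b w) (∷-cong refl (⊗-distribʳ p q w)) ⟩
  (a · w ⊕ b · w) ⊕ ((false ∷ p ⊗ w) ⊕ (false ∷ q ⊗ w))
    ≈⟨ ⊕-interchange (a · w) (b · w) _ _ ⟩
  (a · w ⊕ (false ∷ p ⊗ w)) ⊕ (b · w ⊕ (false ∷ q ⊗ w)) ∎

⊗-assoc : ∀ p q w → (p ⊗ q) ⊗ w ≋ p ⊗ (q ⊗ w)
⊗-assoc []      q w = ≋-refl
⊗-assoc (a ∷ p) q w = begin
  (a · q ⊕ (false ∷ p ⊗ q)) ⊗ w        ≈⟨ ⊗-distribʳ (a · q) (false ∷ p ⊗ q) w ⟩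
  (a · q) ⊗ w ⊕ (false ∷ (p ⊗ q) ⊗ w)  ≈⟨ ⊕-cong (·-⊗ a q w) (∷-cong refl (⊗-assoc p q w)) ⟩
  a · (q ⊗ w) ⊕ (false ∷ p ⊗ (q ⊗ w))  ∎

⊗-distribˡ : ∀ w p q → w ⊗ (p ⊕ q) ≋ w ⊗ p ⊕ w ⊗ q
⊗-distribˡ w p q = begin
  w ⊗ (p ⊕ q)    ≈⟨ ⊗-comm w (p ⊕ q) ⟩
  (p ⊕ q) ⊗ w    ≈⟨ ⊗-distribʳ p q w ⟩
  p ⊗ w ⊕ q ⊗ w  ≈⟨ ⊕-cong (⊗-comm p w) (⊗-comm q w) ⟩
  w ⊗ p ⊕ w ⊗ q  ∎

const-⊗ : ∀ a q → (a ∷ []) ⊗ q ≋ a · q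
const-⊗ a q = ≋-trans (⊕-cong ≋-refl (∷-zero ≋-refl)) (⊕-identityʳ (a · q))

⊗-identityʳ : ∀ p → p ⊗ oneP ≋ p
⊗-identityʳ p = ≋-trans (⊗-comm p oneP) (const-⊗ true p)

polyRing : CommutativeRing _ _
polyRing = record
  { Carrier = Poly ; _≈_ = _≋_ ; _+_ = _⊕_ ; _*_ = _⊗_ ; -_ = id ; 0# = [] ; 1# = oneP
  ; isCommutativeRing = record
    { isRing = record
      { +-isAbelianGroup = ⊕-isAbelianGroup
      ; *-cong = ⊗-cong
      ; *-assoc = ⊗-assoc
      ; *-identity = const-⊗ true , ⊗-identityʳ
      ; distrib = ⊗-distribˡ , λ w p q → ⊗-distribʳ p q w }
    ; *-comm = ⊗-comm } }

module Solver = RingSolver (fromCommutativeRing polyRing λ _ → nothing)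
open Solver using (solve; _⊜_) renaming (_⊕_ to _:+_; _⊗_ to _:*_)

⊕-cancel-middle : ∀ x y z → (x ⊕ y) ⊕ (y ⊕ z) ≋ z ⊕ x
⊕-cancel-middle x y z = begin
  (x ⊕ y) ⊕ (y ⊕ z)  ≈⟨ solve 3 (λ x y z → (x :+ y) :+ (y :+ z) ⊜ ((z :+ x) :+ (y :+ y))) ≋-refl x y z ⟩
  (z ⊕ x) ⊕ (y ⊕ y)  ≈⟨ ⊕-cong ≋-refl (⊕-self y) ⟩
  (z ⊕ x) ⊕ []       ≈⟨ ⊕-identityʳ (z ⊕ x) ⟩
  z ⊕ x              ∎

r-⊗ : ∀ q → r ⊗ q ≋ false ∷ q
r-⊗ q = ∷-cong refl (const-⊗ true q)

∘-⊕ : ∀ p q h → (p ⊕ q) ∘ₚ h ≋ p ∘ₚ h ⊕ q ∘ₚ h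
∘-⊕ []      q       h = ≋-refl
∘-⊕ (a ∷ p) []      h = ≋-sym (⊕-identityʳ _)
∘-⊕ (a ∷ p) (b ∷ q) h = begin
  ((a ∷ []) ⊕ (b ∷ [])) ⊕ h ⊗ (p ⊕ q) ∘ₚ h
    ≈⟨ ⊕-cong ≋-refl (≋-trans (⊗-congʳ h (∘-⊕ p q h)) (⊗-distribˡ h _ _)) ⟩
  ((a ∷ []) ⊕ (b ∷ [])) ⊕ (h ⊗ p ∘ₚ h ⊕ h ⊗ q ∘ₚ h)
    ≈⟨ ⊕-interchange (a ∷ []) (b ∷ []) (h ⊗ p ∘ₚ h) (h ⊗ q ∘ₚ h) ⟩
  ((a ∷ []) ⊕ h ⊗ p ∘ₚ h) ⊕ ((b ∷ []) ⊕ h ⊗ q ∘ₚ h) ∎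

∘-zero : ∀ {p} h → p ≋ [] → p ∘ₚ h ≋ []
∘-zero {[]}    h e = ≋-refl
∘-zero {a ∷ p} h e with ∷≋[]⇒ e
... | a≡false , p≋[] = begin
  (a ∷ []) ⊕ h ⊗ p ∘ₚ h  ≈⟨ ⊕-cong (∷-cong a≡false ≋-refl) (⊗-congʳ h (∘-zero h p≋[])) ⟩
  (false ∷ []) ⊕ h ⊗ []  ≈⟨ ⊕-cong (∷-zero ≋-refl) (⊗-zeroʳ h) ⟩
  []                     ∎

∘-cong : ∀ h {p q} → p ≋ q → p ∘ₚ h ≋ q ∘ₚ h
∘-cong h {[]}    {[]}    e = ≋-refl
∘-cong h {[]}    {b ∷ q} e = ≋-sym (∘-zero h (≋-sym e))
∘-cong h {a ∷ p} {[]}    e = ∘-zero h e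
∘-cong h {a ∷ p} {b ∷ q} e with ∷-injective e
... | a≡b , p≋q = ⊕-cong (∷-cong a≡b ≋-refl) (⊗-congʳ h (∘-cong h p≋q))

·-∘ : ∀ a q h → (a · q) ∘ₚ h ≋ a · q ∘ₚ h
·-∘ true  q h = ≋-refl
·-∘ false q h = ≋-refl

const-∘ : ∀ a h → (a ∷ []) ∘ₚ h ≋ a ∷ []
const-∘ a h = ≋-trans (⊕-cong ≋-refl (⊗-zeroʳ h)) (⊕-identityʳ (a ∷ []))

shift-∘ : ∀ p h → (false ∷ p) ∘ₚ h ≋ h ⊗ p ∘ₚ h
shift-∘ p h = ⊕-cong (∷-zero ≋-refl) ≋-refl

∘-⊗ : ∀ p q h → (p ⊗ q) ∘ₚ h ≋ p ∘ₚ h ⊗ q ∘ₚ h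
∘-⊗ []      q h = ≋-refl
∘-⊗ (a ∷ p) q h = begin
  (a · q ⊕ (false ∷ p ⊗ q)) ∘ₚ h
    ≈⟨ ∘-⊕ (a · q) (false ∷ p ⊗ q) h ⟩
  (a · q) ∘ₚ h ⊕ (false ∷ p ⊗ q) ∘ₚ h
    ≈⟨ ⊕-cong (·-∘ a q h) (≋-trans (shift-∘ (p ⊗ q) h) (⊗-congʳ h (∘-⊗ p q h))) ⟩
  a · q ∘ₚ h ⊕ h ⊗ (p ∘ₚ h ⊗ q ∘ₚ h)
    ≈⟨ ⊕-cong (const-⊗ a (q ∘ₚ h)) (⊗-assoc h (p ∘ₚ h) (q ∘ₚ h)) ⟨
  (a ∷ []) ⊗ q ∘ₚ h ⊕ (h ⊗ p ∘ₚ h) ⊗ q ∘ₚ h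
    ≈⟨ ⊗-distribʳ (a ∷ []) (h ⊗ p ∘ₚ h) (q ∘ₚ h) ⟨
  ((a ∷ []) ⊕ h ⊗ p ∘ₚ h) ⊗ q ∘ₚ h ∎

r-∘ : ∀ h → r ∘ₚ h ≋ h
r-∘ h = ≋-trans (shift-∘ oneP h) (≋-trans (⊗-congʳ h (const-∘ true h)) (⊗-identityʳ h))

^-cong : ∀ {p q} n → p ≋ q → p ^ₚ n ≋ q ^ₚ n
^-cong zero    e = ≋-refl
^-cong (suc n) e = ⊗-cong e (^-cong n e)

^-∘ : ∀ p n h → (p ^ₚ n) ∘ₚ h ≋ (p ∘ₚ h) ^ₚ n
^-∘ p zero    h = const-∘ true h
^-∘ p (suc n) h = ≋-trans (∘-⊗ p (p ^ₚ n) h) (⊗-congʳ (p ∘ₚ h) (^-∘ p n h))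

trimCons : Bool → Poly → Poly
trimCons false [] = []
trimCons a     p  = a ∷ p

trim : Poly → Poly
trim []      = []
trim (a ∷ p) = trimCons a (trim p)

trimCons-≋ : ∀ a p → trimCons a p ≋ a ∷ p
trimCons-≋ false []      = ≋-sym (∷-zero ≋-refl)
trimCons-≋ false (b ∷ p) = ≋-refl
trimCons-≋ true  p       = ≋-refl

trim-≋ : ∀ p → trim p ≋ p
trim-≋ []      = ≋-refl
trim-≋ (a ∷ p) = ≋-trans (trimCons-≋ a (trim p)) (∷-cong refl (trim-≋ p))

≋-byTrim : ∀ {p q} → trim p ≡ trim q → p ≋ q
≋-byTrim {p} {q} e = ≋-trans (≋-sym (trim-≋ p)) (≋-trans (coeffwise λ n → cong (λ w → coeff w n) e) (trim-≋ q))

-- Recursive rather than n + n, so that double (suc n) and odd (suc n) unfold definitionally.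
double : ℕ → ℕ
double zero    = zero
double (suc n) = suc (suc (double n))

odd : ℕ → ℕ
odd n = suc (double n)

double-mono-≤ : ∀ {m n} → m ≤ n → double m ≤ double n
double-mono-≤ z≤n       = z≤n
double-mono-≤ (s≤s m≤n) = s≤s (s≤s (double-mono-≤ m≤n))

double-mono-< : ∀ {m n} → m < n → double m < double n
double-mono-< (s≤s m≤n) = s≤s (m≤n⇒m≤1+n (double-mono-≤ m≤n))

odd-mono-< : ∀ {m n} → m < n → odd m < odd n
odd-mono-< m<n = s≤s (double-mono-< m<n)

odd<double : ∀ {m n} → m < n → odd m < double n
odd<double (s≤s m≤n) = s≤s (s≤s (double-mono-≤ m≤n))

double-double≤ : ∀ m → double (double m) ≤ 3 + 4 * m
double-double≤ m = ≤-trans (≤-reflexive (double-double m)) (m≤n+m (4 * m) 3)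
  where
  double-double : ∀ m → double (double m) ≡ 4 * m
  double-double zero    = refl
  double-double (suc m) = trans (cong (4 +_) (double-double m)) (sym (*-suc 4 m))

record DegLt (p : Poly) (d : ℕ) : Set where
  constructor degLt
  field vanishes : ∀ n → d ≤ n → coeff p n ≡ false
open DegLt

DegLt-resp : ∀ {p q d} → p ≋ q → DegLt q d → DegLt p d
DegLt-resp (coeffwise e) (degLt v) = degLt λ n d≤n → trans (e n) (v n d≤n)

DegLt-mono : ∀ {p d d′} → d ≤ d′ → DegLt p d → DegLt p d′
DegLt-mono d≤d′ (degLt v) = degLt λ n d′≤n → v n (≤-trans d≤d′ d′≤n)

DegLt-[] : ∀ {d} → DegLt [] d
DegLt-[] = degLt λ _ _ → refl

DegLt-⊕ : ∀ {p q d} → DegLt p d → DegLt q d → DegLt (p ⊕ q) d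
DegLt-⊕ {p} {q} (degLt v) (degLt w) =
  degLt λ n d≤n → trans (coeff-⊕ p q n) (cong₂ _xor_ (v n d≤n) (w n d≤n))

DegLt-shift : ∀ {p d} → DegLt p d → DegLt (false ∷ p) (suc d)
DegLt-shift (degLt v) = degLt λ { (suc n) (s≤s d≤n) → v n d≤n }

DegLt-pred : ∀ {p d} → DegLt p (suc d) → coeff p d ≡ false → DegLt p d
DegLt-pred {d = d} (degLt v) top≡false = degLt λ n d≤n → case m≤n⇒m<n∨m≡n d≤n of λ
  { (inj₁ d<n)  → v n d<n
  ; (inj₂ refl) → top≡false }

DegLt-zero⇒≋[] : ∀ {p} → DegLt p 0 → p ≋ []
DegLt-zero⇒≋[] (degLt v) = coeffwise λ n → v n z≤n

·-DegLt : ∀ a {p d} → DegLt p d → DegLt (a · p) d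
·-DegLt true  p<d = p<d
·-DegLt false p<d = DegLt-[]

combination-DegLt : ∀ {d} k (v : Fin k → Poly) (c : Fin k → Bool) → (∀ i → DegLt (v i) d) →
                    DegLt (sumP k (λ i → c i · v i)) d
combination-DegLt zero    v c v<d = DegLt-[]
combination-DegLt (suc k) v c v<d =
  DegLt-⊕ (·-DegLt (c zero) (v<d zero)) (combination-DegLt k (λ i → v (suc i)) (λ i → c (suc i)) (λ i → v<d (suc i)))

LinIndep-cons : ∀ {k} d (v : Fin (suc k) → Poly) → coeff (v zero) d ≡ true → (∀ i → DegLt (v (suc i)) d) →
                LinIndep k (λ i → v (suc i)) → LinIndep (suc k) v
LinIndep-cons {k} d v leading tail<d indep c Σ≈0 = λ
  { zero    → c₀≡false
  ; (suc i) → indep (λ i → c (suc i)) (subst (λ a → a · v zero ⊕ tail ≈ []) c₀≡false Σ≈0) i }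
  where
  tail = sumP k (λ i → c (suc i) · v (suc i))
  c₀≡false : c zero ≡ false
  c₀≡false = onlyFalse (c zero) (Σ≈0 d)
    where
    onlyFalse : ∀ a → coeff (a · v zero ⊕ tail) d ≡ false → a ≡ false
    onlyFalse false _ = refl
    onlyFalse true  e = trans (sym (trans (coeff-⊕ (v zero) tail d)
      (cong₂ _xor_ leading (vanishes (combination-DegLt k _ _ tail<d) d ≤-refl)))) e

record EvenPoly (p : Poly) : Set where
  constructor evenPoly
  field oddVanishes : ∀ k → coeff p (odd k) ≡ false
open EvenPoly

EvenPoly-resp : ∀ {p q} → p ≋ q → EvenPoly q → EvenPoly p
EvenPoly-resp (coeffwise e) (evenPoly v) = evenPoly λ k → trans (e (odd k)) (v k)

EvenPoly-[] : EvenPoly []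
EvenPoly-[] = evenPoly λ _ → refl

EvenPoly-⊕ : ∀ {p q} → EvenPoly p → EvenPoly q → EvenPoly (p ⊕ q)
EvenPoly-⊕ {p} {q} (evenPoly v) (evenPoly w) =
  evenPoly λ k → trans (coeff-⊕ p q (odd k)) (cong₂ _xor_ (v k) (w k))

EvenPoly-shift² : ∀ {p} → EvenPoly p → EvenPoly (false ∷ false ∷ p)
EvenPoly-shift² (evenPoly v) = evenPoly λ { zero → refl ; (suc k) → v k }

record Pivot (i : ℕ) (b : Poly) : Set where
  field
    even    : EvenPoly b
    below   : DegLt b (suc (double i))
    leading : coeff b (double i) ≡ true

Pivot-resp : ∀ {i p q} → p ≋ q → Pivot i q → Pivot i p
Pivot-resp p≋q b = record
  { even    = EvenPoly-resp p≋q (Pivot.even b)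
  ; below   = DegLt-resp p≋q (Pivot.below b)
  ; leading = trans (≋⇒≈ p≋q _) (Pivot.leading b) }

pivot-1 : Pivot 0 oneP
pivot-1 = record
  { even    = evenPoly λ _ → refl
  ; below   = degLt λ { (suc n) _ → refl }
  ; leading = refl }

pivot-t² : Pivot 1 (false ∷ false ∷ true ∷ [])
pivot-t² = record
  { even    = evenPoly λ { zero → refl ; (suc k) → refl }
  ; below   = degLt λ { (suc (suc (suc n))) _ → refl ; (suc zero) (s≤s ()) ; (suc (suc zero)) (s≤s (s≤s ())) }
  ; leading = refl }

-- Coordinates over ℤ/2[H] and the map U

s s² s³ s⁴ : Poly
s  = r ^ₚ 2 ⊕ r
s² = s ⊗ s
s³ = s ⊗ s²
s⁴ = s ⊗ s³

s-⊗ : ∀ q → s ⊗ q ≋ (false ∷ false ∷ q) ⊕ (false ∷ q)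
s-⊗ q = begin
  (r ⊗ (r ⊗ oneP) ⊕ r) ⊗ q         ≈⟨ ⊗-distribʳ (r ⊗ (r ⊗ oneP)) r q ⟩
  (r ⊗ (r ⊗ oneP)) ⊗ q ⊕ r ⊗ q     ≈⟨ ⊕-cong (⊗-cong (⊗-congʳ r (⊗-identityʳ r)) (≋-refl {q})) (≋-refl {r ⊗ q}) ⟩
  (r ⊗ r) ⊗ q ⊕ r ⊗ q              ≈⟨ ⊕-cong (⊗-assoc r r q) (≋-refl {r ⊗ q}) ⟩
  r ⊗ (r ⊗ q) ⊕ r ⊗ q              ≈⟨ ⊕-cong (≋-trans (⊗-congʳ r (r-⊗ q)) (r-⊗ (false ∷ q))) (r-⊗ q) ⟩
  (false ∷ false ∷ q) ⊕ (false ∷ q) ∎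

s^-DegLt : ∀ n → DegLt (s ^ₚ n) (suc (double n))
s^-DegLt zero    = Pivot.below pivot-1
s^-DegLt (suc n) = DegLt-resp (s-⊗ (s ^ₚ n))
  (DegLt-⊕ (DegLt-shift (DegLt-shift (s^-DegLt n))) (DegLt-mono (n≤1+n _) (DegLt-shift (s^-DegLt n))))

s^-leading : ∀ n → coeff (s ^ₚ n) (double n) ≡ true
s^-leading zero    = refl
s^-leading (suc n) = trans (≋⇒≈ (s-⊗ (s ^ₚ n)) (double (suc n)))
  (trans (coeff-⊕ (false ∷ false ∷ s ^ₚ n) (false ∷ s ^ₚ n) (double (suc n)))
         (cong₂ _xor_ (s^-leading n) (vanishes (s^-DegLt n) (suc (double n)) ≤-refl)))

sumPoly : List Poly → Poly
sumPoly = foldr _⊕_ []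

powSum : List ℕ → Poly
powSum ns = sumPoly (map (s ^ₚ_) ns)

powSum-DegLt : ∀ {n} ns → All (_< n) ns → DegLt (powSum ns) (double n)
powSum-DegLt []       []           = DegLt-[]
powSum-DegLt (m ∷ ns) (m<n ∷ ns<n) = DegLt-⊕ (DegLt-mono (double-mono-< m<n) (s^-DegLt m)) (powSum-DegLt ns ns<n)

record Coords : Set where
  constructor coords
  field c₀ c₁ c₂ c₃ : Poly
open Coords

evalAt : Poly → Coords → Poly
evalAt H x = c₀ x ∘ₚ H ⊕ c₁ x ∘ₚ H ⊗ s ⊕ c₂ x ∘ₚ H ⊗ s² ⊕ c₃ x ∘ₚ H ⊗ s³

-- Multiplication by s, reduced with s⁴ = H s + H²; false ∷ p is t · p.
mulS : Coords → Coords
mulS x = coords (false ∷ false ∷ c₃ x) (c₀ x ⊕ (false ∷ c₃ x)) (c₁ x) (c₂ x)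

powCoords : ℕ → Coords
powCoords zero    = coords oneP [] [] []
powCoords (suc n) = mulS (powCoords n)

_⊕ᶜ_ : Coords → Coords → Coords
x ⊕ᶜ y = coords (c₀ x ⊕ c₀ y) (c₁ x ⊕ c₁ y) (c₂ x ⊕ c₂ y) (c₃ x ⊕ c₃ y)

evalAt-⊕ᶜ : ∀ H x y → evalAt H (x ⊕ᶜ y) ≋ evalAt H x ⊕ evalAt H y
evalAt-⊕ᶜ H (coords a b c d) (coords a′ b′ c′ d′) = begin
  (a ⊕ a′) ∘ₚ H ⊕ (b ⊕ b′) ∘ₚ H ⊗ s ⊕ (c ⊕ c′) ∘ₚ H ⊗ s² ⊕ (d ⊕ d′) ∘ₚ H ⊗ s³
    ≈⟨ ⊕-cong (⊕-cong (⊕-cong (∘-⊕ a a′ H) (⊗-cong (∘-⊕ b b′ H) ≋-refl))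
                      (⊗-cong (∘-⊕ c c′ H) ≋-refl)) (⊗-cong (∘-⊕ d d′ H) ≋-refl) ⟩
  (A ⊕ A′) ⊕ (B ⊕ B′) ⊗ s ⊕ (C ⊕ C′) ⊗ s² ⊕ (D ⊕ D′) ⊗ s³
    ≈⟨ solve 9 (λ A B C D A′ B′ C′ D′ S →
         (A :+ A′) :+ (B :+ B′) :* S :+ (C :+ C′) :* (S :* S) :+ (D :+ D′) :* (S :* (S :* S))
         ⊜ (A :+ B :* S :+ C :* (S :* S) :+ D :* (S :* (S :* S))
            :+ (A′ :+ B′ :* S :+ C′ :* (S :* S) :+ D′ :* (S :* (S :* S)))))
       ≋-refl A B C D A′ B′ C′ D′ s ⟩
  (A ⊕ B ⊗ s ⊕ C ⊗ s² ⊕ D ⊗ s³) ⊕ (A′ ⊕ B′ ⊗ s ⊕ C′ ⊗ s² ⊕ D′ ⊗ s³) ∎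
  where
  A = a ∘ₚ H
  B = b ∘ₚ H
  C = c ∘ₚ H
  D = d ∘ₚ H
  A′ = a′ ∘ₚ H
  B′ = b′ ∘ₚ H
  C′ = c′ ∘ₚ H
  D′ = d′ ∘ₚ H

sumCoords : List ℕ → Coords
sumCoords ns = foldr _⊕ᶜ_ (coords [] [] [] []) (map powCoords ns)

QuarticOver : Poly → Set
QuarticOver H = s⁴ ≋ H ⊗ s ⊕ H ⊗ H

quarticOver-G : QuarticOver G
quarticOver-G = ≋-byTrim refl

quarticOver-F : QuarticOver F
quarticOver-F = ≋-byTrim refl

evalAt-mulS : ∀ H → QuarticOver H → ∀ x → evalAt H (mulS x) ≋ s ⊗ evalAt H x
evalAt-mulS H quartic (coords a b c d) = begin
  (false ∷ false ∷ d) ∘ₚ H ⊕ (a ⊕ (false ∷ d)) ∘ₚ H ⊗ s ⊕ B ⊗ s² ⊕ C ⊗ s³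
    ≈⟨ ⊕-cong (⊕-cong (⊕-cong constant (⊗-cong linear ≋-refl)) ≋-refl) ≋-refl ⟩
  H ⊗ (H ⊗ D) ⊕ (A ⊕ H ⊗ D) ⊗ s ⊕ B ⊗ s² ⊕ C ⊗ s³
    ≈⟨ solve 6 (λ A B C D H S →
         H :* (H :* D) :+ (A :+ H :* D) :* S :+ B :* (S :* S) :+ C :* (S :* (S :* S))
         ⊜ (A :* S :+ B :* (S :* S) :+ C :* (S :* (S :* S)) :+ D :* (H :* S :+ H :* H)))
       ≋-refl A B C D H s ⟩
  A ⊗ s ⊕ B ⊗ s² ⊕ C ⊗ s³ ⊕ D ⊗ (H ⊗ s ⊕ H ⊗ H)
    ≈⟨ ⊕-cong ≋-refl (⊗-congʳ D quartic) ⟨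
  A ⊗ s ⊕ B ⊗ s² ⊕ C ⊗ s³ ⊕ D ⊗ s⁴
    ≈⟨ solve 5 (λ A B C D S →
         A :* S :+ B :* (S :* S) :+ C :* (S :* (S :* S)) :+ D :* (S :* (S :* (S :* S)))
         ⊜ S :* (A :+ B :* S :+ C :* (S :* S) :+ D :* (S :* (S :* S))))
       ≋-refl A B C D s ⟩
  s ⊗ (A ⊕ B ⊗ s ⊕ C ⊗ s² ⊕ D ⊗ s³) ∎
  where
  A = a ∘ₚ H
  B = b ∘ₚ H
  C = c ∘ₚ H
  D = d ∘ₚ H
  constant : (false ∷ false ∷ d) ∘ₚ H ≋ H ⊗ (H ⊗ D)
  constant = ≋-trans (shift-∘ (false ∷ d) H) (⊗-congʳ H (shift-∘ d H))
  linear : (a ⊕ (false ∷ d)) ∘ₚ H ≋ A ⊕ H ⊗ D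
  linear = ≋-trans (∘-⊕ a (false ∷ d) H) (⊕-cong ≋-refl (shift-∘ d H))

^-evalAt : ∀ H → QuarticOver H → ∀ n → s ^ₚ n ≋ evalAt H (powCoords n)
^-evalAt H quartic zero    = ≋-sym (≋-trans (⊕-identityʳ _) (≋-trans (⊕-identityʳ _)
                                 (≋-trans (⊕-identityʳ _) (const-∘ true H))))
^-evalAt H quartic (suc n) = ≋-trans (⊗-congʳ s (^-evalAt H quartic n))
                                       (≋-sym (evalAt-mulS H quartic (powCoords n)))

powSum-evalAt : ∀ H → QuarticOver H → ∀ ns → powSum ns ≋ evalAt H (sumCoords ns)
powSum-evalAt H quartic []       = ≋-refl
powSum-evalAt H quartic (n ∷ ns) =
  ≋-trans (⊕-cong (^-evalAt H quartic n) (powSum-evalAt H quartic ns))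
          (≋-sym (evalAt-⊕ᶜ H (powCoords n) (sumCoords ns)))

-- Both s = e₁ + e₂ and s² = H + e₂ + e₃ hold for e = 1, r, r², r³ over ℤ/2[G] and for
-- e = U(1), …, U(r³) over ℤ/2[F]; substituting them into a + b s + c s² gives these coefficients.
uCoeffs : Poly → Poly → Poly → Fin 4 → Poly
uCoeffs a b c zero                   = a ⊕ r ⊗ c
uCoeffs a b c (suc zero)             = b
uCoeffs a b c (suc (suc zero))       = b ⊕ c
uCoeffs a b c (suc (suc (suc zero))) = c

evalAt-inBasis : ∀ H (e : Fin 4 → Poly) → e zero ≋ oneP → s ≋ e (# 1) ⊕ e (# 2) →
                 s² ≋ H ⊕ (e (# 2) ⊕ e (# 3)) → ∀ a b c →
                 evalAt H (coords a b c []) ≋ sumP 4 (λ i → uCoeffs a b c i ∘ₚ H ⊗ e i)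
evalAt-inBasis H e e₀≋1 s≋ s²≋ a b c = begin
  A ⊕ B ⊗ s ⊕ C ⊗ s² ⊕ []
    ≈⟨ ⊕-identityʳ _ ⟩
  A ⊕ B ⊗ s ⊕ C ⊗ s²
    ≈⟨ ⊕-cong (⊕-cong ≋-refl (⊗-congʳ B s≋)) (⊗-congʳ C s²≋) ⟩
  A ⊕ B ⊗ (e₁ ⊕ e₂) ⊕ C ⊗ (H ⊕ (e₂ ⊕ e₃))
    ≈⟨ solve 7 (λ A B C H e₁ e₂ e₃ →
         A :+ B :* (e₁ :+ e₂) :+ C :* (H :+ (e₂ :+ e₃))
         ⊜ (A :+ H :* C :+ (B :* e₁ :+ ((B :+ C) :* e₂ :+ C :* e₃))))
       ≋-refl A B C H e₁ e₂ e₃ ⟩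
  A ⊕ H ⊗ C ⊕ (B ⊗ e₁ ⊕ ((B ⊕ C) ⊗ e₂ ⊕ C ⊗ e₃))
    ≈⟨ ⊕-cong constant (⊕-cong (≋-refl {B ⊗ e₁}) (⊕-cong quadratic (≋-sym (⊕-identityʳ (C ⊗ e₃))))) ⟩
  sumP 4 (λ i → uCoeffs a b c i ∘ₚ H ⊗ e i) ∎
  where
  A = a ∘ₚ H
  B = b ∘ₚ H
  C = c ∘ₚ H
  e₁ = e (# 1)
  e₂ = e (# 2)
  e₃ = e (# 3)
  constant : A ⊕ H ⊗ C ≋ (a ⊕ r ⊗ c) ∘ₚ H ⊗ e zero
  constant = begin
    A ⊕ H ⊗ C                     ≈⟨ ⊕-cong ≋-refl (⊗-cong (r-∘ H) ≋-refl) ⟨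
    A ⊕ r ∘ₚ H ⊗ C                ≈⟨ ⊕-cong ≋-refl (∘-⊗ r c H) ⟨
    A ⊕ (r ⊗ c) ∘ₚ H              ≈⟨ ∘-⊕ a (r ⊗ c) H ⟨
    (a ⊕ r ⊗ c) ∘ₚ H              ≈⟨ ⊗-identityʳ _ ⟨
    (a ⊕ r ⊗ c) ∘ₚ H ⊗ oneP       ≈⟨ ⊗-congʳ ((a ⊕ r ⊗ c) ∘ₚ H) e₀≋1 ⟨
    (a ⊕ r ⊗ c) ∘ₚ H ⊗ e zero     ∎
  quadratic : (B ⊕ C) ⊗ e₂ ≋ (b ⊕ c) ∘ₚ H ⊗ e₂
  quadratic = ⊗-cong (≋-sym (∘-⊕ b c H)) ≋-refl

UGraph-evalAt : ∀ a b c → UGraph (evalAt G (coords a b c [])) (evalAt F (coords a b c []))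
UGraph-evalAt a b c = uCoeffs a b c
  , ≋⇒≈ (evalAt-inBasis G (λ i → r ^ₚ toℕ i) ≋-refl (≋-byTrim refl) (≋-byTrim refl) a b c)
  , ≋⇒≈ (evalAt-inBasis F Ubasis ≋-refl (≋-byTrim refl) (≋-byTrim refl) a b c)

UGraph-resp : ∀ {f f′ h h′} → f ≋ f′ → h ≋ h′ → UGraph f h → UGraph f′ h′
UGraph-resp f≋f′ h≋h′ (g , f≈ , h≈) =
  g , (λ n → trans (sym (≋⇒≈ f≋f′ n)) (f≈ n)) , (λ n → trans (sym (≋⇒≈ h≋h′ n)) (h≈ n))

UGraph-fixed : ∀ {f} x → c₃ x ≋ [] → f ≋ evalAt G x → f ≋ evalAt F x → UGraph f f
UGraph-fixed {f} x c₃≋[] f≋G f≋F = UGraph-resp (withoutCubic f≋G) (withoutCubic f≋F) (UGraph-evalAt (c₀ x) (c₁ x) (c₂ x))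
  where
  withoutCubic : ∀ {H} → f ≋ evalAt H x → evalAt H (coords (c₀ x) (c₁ x) (c₂ x) []) ≋ f
  withoutCubic {H} f≋H = ≋-sym (≋-trans f≋H (⊕-cong ≋-refl (⊗-cong (∘-cong H c₃≋[]) ≋-refl)))

cubic : ℕ → Poly
cubic n = c₃ (powCoords n)

c₃-sumCoords : ∀ ns → c₃ (sumCoords ns) ≡ sumPoly (map cubic ns)
c₃-sumCoords []       = refl
c₃-sumCoords (n ∷ ns) = cong (cubic n ⊕_) (c₃-sumCoords ns)

powSum-fixed : ∀ ns → sumPoly (map cubic ns) ≋ [] → UGraph (powSum ns) (powSum ns)
powSum-fixed ns Σcubic≋[] = UGraph-fixed (sumCoords ns) (subst (_≋ []) (sym (c₃-sumCoords ns)) Σcubic≋[])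
  (powSum-evalAt G quarticOver-G ns) (powSum-evalAt F quarticOver-F ns)

-- The s³-coordinates of odd powers of s

γ : ℕ → Poly
γ h = cubic (odd h)

-- cubic (4 + n) unfolds to t² · cubic n + t · cubic (1 + n); in the twice unfolded
-- cubic (8 + n) the two terms t³ · cubic (1 + n) cancel.
cubic-rec : ∀ n → cubic (8 + n) ≋ (false ∷ false ∷ cubic (2 + n)) ⊕ (false ∷ false ∷ false ∷ false ∷ cubic n)
cubic-rec n = ⊕-cancel-middle (false ∷ false ∷ false ∷ false ∷ cubic n) (false ∷ false ∷ false ∷ cubic (1 + n))
                              (false ∷ false ∷ cubic (2 + n))

γ-double-rec : ∀ i → γ (double (2 + i)) ≋ (false ∷ false ∷ γ (odd i)) ⊕ (false ∷ false ∷ false ∷ false ∷ γ (double i))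
γ-double-rec i = cubic-rec (odd (double i))

γ-odd-rec : ∀ i → γ (odd (2 + i)) ≋ (false ∷ false ∷ γ (double (suc i))) ⊕ (false ∷ false ∷ false ∷ false ∷ γ (odd i))
γ-odd-rec i = cubic-rec (odd (odd i))

record Invariant (i : ℕ) : Set where
  field
    γ-double-even  : EvenPoly (γ (double i))
    γ-double-below : DegLt (γ (double i)) (double i)
    γ-odd-pivot    : Pivot i (γ (odd i))
open Invariant

invariant-step : ∀ {i} → Invariant i → Invariant (suc i) → Invariant (suc (suc i))
invariant-step {i} I I′ = record
  { γ-double-even  = EvenPoly-resp (γ-double-rec i)
                       (EvenPoly-⊕ (EvenPoly-shift² (even b)) (EvenPoly-shift² (EvenPoly-shift² (γ-double-even I))))
  ; γ-double-below = DegLt-resp (γ-double-rec i)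
                       (DegLt-⊕ (DegLt-mono (n≤1+n _) (shift² (below b))) (shift² (shift² (γ-double-below I))))
  ; γ-odd-pivot    = record
    { even    = EvenPoly-resp (γ-odd-rec i)
                  (EvenPoly-⊕ (EvenPoly-shift² (γ-double-even I′)) (EvenPoly-shift² (EvenPoly-shift² (even b))))
    ; below   = DegLt-resp (γ-odd-rec i)
                  (DegLt-⊕ (DegLt-mono (n≤1+n _) (shift² (γ-double-below I′))) (shift² (shift² (below b))))
    ; leading = trans (≋⇒≈ (γ-odd-rec i) (double (2 + i)))
                  (trans (coeff-⊕ (γ (double (suc i))) (false ∷ false ∷ γ (odd i)) (double (suc i)))
                         (cong₂ _xor_ (vanishes (γ-double-below I′) (double (suc i)) ≤-refl) (leading b))) } }
  where
  open Pivot
  b = γ-odd-pivot I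
  shift² : ∀ {p d} → DegLt p d → DegLt (false ∷ false ∷ p) (suc (suc d))
  shift² p<d = DegLt-shift (DegLt-shift p<d)

invariant-0 : Invariant 0
invariant-0 = record
  { γ-double-even  = EvenPoly-resp (≋-byTrim refl) EvenPoly-[]
  ; γ-double-below = DegLt-resp (≋-byTrim refl) DegLt-[]
  ; γ-odd-pivot    = Pivot-resp (≋-byTrim refl) pivot-1 }

invariant-1 : Invariant 1
invariant-1 = record
  { γ-double-even  = EvenPoly-resp (≋-byTrim refl) EvenPoly-[]
  ; γ-double-below = DegLt-resp (≋-byTrim refl) DegLt-[]
  ; γ-odd-pivot    = Pivot-resp (≋-byTrim refl) pivot-t² }

invariant : ∀ i → Invariant i
invariant i = proj₁ (invariants i)
  where
  invariants : ∀ i → Invariant i × Invariant (suc i)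
  invariants zero    = invariant-0 , invariant-1
  invariants (suc i) = proj₂ (invariants i) , invariant-step (proj₁ (invariants i)) (proj₂ (invariants i))

SpannedBy : (ℕ → Poly) → ℕ → Poly → Set
SpannedBy b k v = Σ (List ℕ) λ S → All (_< k) S × v ⊕ sumPoly (map b S) ≋ []

SpannedBy-suc : ∀ {b k v} → SpannedBy b k v → SpannedBy b (suc k) v
SpannedBy-suc (S , S<k , Σ≋[]) = S , All.map m<n⇒m<1+n S<k , Σ≋[]

SpannedBy-cons : ∀ {b k v} → SpannedBy b k (v ⊕ b k) → SpannedBy b (suc k) v
SpannedBy-cons {b} {k} {v} (S , S<k , Σ≋[]) =
  k ∷ S , ≤-refl ∷ All.map m<n⇒m<1+n S<k , ≋-trans (≋-sym (⊕-assoc v (b k) _)) Σ≋[]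

-- Gaussian elimination from the top degree down; evenness of v makes its odd coefficients vanish.
spannedBy-pivots : ∀ (b : ℕ → Poly) → (∀ i → Pivot i (b i)) →
                   ∀ k {v} → EvenPoly v → DegLt v (double k) → SpannedBy b k v
spannedBy-pivots b pivots zero    {v} _      v<0    = [] , [] , ≋-trans (⊕-identityʳ v) (DegLt-zero⇒≋[] v<0)
spannedBy-pivots b pivots (suc k) {v} even-v v<2k+2 = eliminate (coeff v (double k)) refl
  where
  open Pivot (pivots k)
  v<2k+1 : DegLt v (suc (double k))
  v<2k+1 = DegLt-pred v<2k+2 (oddVanishes even-v k)
  eliminate : ∀ c → coeff v (double k) ≡ c → SpannedBy b (suc k) v
  eliminate false vₖ≡false = SpannedBy-suc (spannedBy-pivots b pivots k even-v (DegLt-pred v<2k+1 vₖ≡false))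
  eliminate true  vₖ≡true  = SpannedBy-cons (spannedBy-pivots b pivots k (EvenPoly-⊕ even-v even)
    (DegLt-pred (DegLt-⊕ v<2k+1 below) (trans (coeff-⊕ v (b k) (double k)) (cong₂ _xor_ vₖ≡true leading))))

-- The elements of K_m

s∘r² : s ∘ₚ r ^ₚ 2 ≋ s²
s∘r² = ≋-byTrim refl

^-double : ∀ p h → (p ⊗ p) ^ₚ h ≋ p ^ₚ double h
^-double p zero    = ≋-refl
^-double p (suc h) = ≋-trans (⊗-congʳ (p ⊗ p) (^-double p h)) (⊗-assoc p p (p ^ₚ double h))

oddPowSum-Lstar : ∀ hs → powSum (map odd hs) ≋ s ⊗ powSum hs ∘ₚ r ^ₚ 2
oddPowSum-Lstar []       = ≋-sym (⊗-zeroʳ s)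
oddPowSum-Lstar (h ∷ hs) = begin
  s ⊗ s ^ₚ double h ⊕ powSum (map odd hs)
    ≈⟨ ⊕-cong (⊗-congʳ s oddPower) (oddPowSum-Lstar hs) ⟩
  s ⊗ (s ^ₚ h) ∘ₚ r ^ₚ 2 ⊕ s ⊗ powSum hs ∘ₚ r ^ₚ 2
    ≈⟨ ⊗-distribˡ s ((s ^ₚ h) ∘ₚ r ^ₚ 2) (powSum hs ∘ₚ r ^ₚ 2) ⟨
  s ⊗ ((s ^ₚ h) ∘ₚ r ^ₚ 2 ⊕ powSum hs ∘ₚ r ^ₚ 2)
    ≈⟨ ⊗-congʳ s (∘-⊕ (s ^ₚ h) (powSum hs) (r ^ₚ 2)) ⟨
  s ⊗ powSum (h ∷ hs) ∘ₚ r ^ₚ 2 ∎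
  where
  oddPower : s ^ₚ double h ≋ (s ^ₚ h) ∘ₚ r ^ₚ 2
  oddPower = ≋-sym (≋-trans (^-∘ s h (r ^ₚ 2)) (≋-trans (^-cong h s∘r²) (^-double s h)))

γ-double-spanned : ∀ j → SpannedBy (λ i → γ (odd i)) j (γ (double j))
γ-double-spanned j = spannedBy-pivots (λ i → γ (odd i)) (λ i → γ-odd-pivot (invariant i)) j
  (γ-double-even (invariant j)) (γ-double-below (invariant j))

halfExponents : ℕ → List ℕ
halfExponents j = double j ∷ map odd (proj₁ (γ-double-spanned j))

kernelElement : ℕ → Poly
kernelElement j = powSum (map odd (halfExponents j))

kernelElement-fixed : ∀ j → UGraph (kernelElement j) (kernelElement j)
kernelElement-fixed j = powSum-fixed (map odd (halfExponents j))
  (subst (λ xs → γ (double j) ⊕ sumPoly xs ≋ []) reindex (proj₂ (proj₂ (γ-double-spanned j))))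
  where
  S = proj₁ (γ-double-spanned j)
  reindex : map (λ i → γ (odd i)) S ≡ map cubic (map odd (map odd S))
  reindex = trans (map-∘ S) (map-∘ (map odd S))

odd-exponents<double : ∀ j → All (_< double j) (map odd (proj₁ (γ-double-spanned j)))
odd-exponents<double j = All-map⁺ (All.map odd<double (proj₁ (proj₂ (γ-double-spanned j))))

kernelElement-Lstar : ∀ j → InLstar j (kernelElement j)
kernelElement-Lstar j = powSum (halfExponents j) , degLe , ≋⇒≈ (oddPowSum-Lstar (halfExponents j))
  where
  g<4j+1 : DegLt (powSum (halfExponents j)) (suc (double (double j)))
  g<4j+1 = DegLt-⊕ (s^-DegLt (double j)) (DegLt-mono (n≤1+n _) (powSum-DegLt _ (odd-exponents<double j)))
  degLe : DegLe (powSum (halfExponents j)) (3 + 4 * j)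
  degLe n 3+4j<n = vanishes g<4j+1 n (≤-trans (s≤s (double-double≤ j)) 3+4j<n)

InK-suc : ∀ {m f} → InK m f → InK (suc m) f
InK-suc {m} ((g , degLe , f≈) , fixed) = (g , degLe′ , f≈) , fixed
  where
  degLe′ : DegLe g (3 + 4 * suc m)
  degLe′ n d<n = degLe n (≤-trans (s≤s (+-monoʳ-≤ 3 (*-monoʳ-≤ 4 (n≤1+n m)))) d<n)

topDegree : ℕ → ℕ
topDegree j = double (odd (double j))

topDegree-mono : ∀ {j m} → j < m → topDegree j < topDegree m
topDegree-mono j<m = double-mono-< (odd-mono-< (double-mono-< j<m))

kernelElement-tail : ℕ → Poly
kernelElement-tail j = powSum (map odd (map odd (proj₁ (γ-double-spanned j))))

kernelElement-tail<topDegree : ∀ j → DegLt (kernelElement-tail j) (topDegree j)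
kernelElement-tail<topDegree j = powSum-DegLt _ (All-map⁺ (All.map odd-mono-< (odd-exponents<double j)))

kernelElement-leading : ∀ j → coeff (kernelElement j) (topDegree j) ≡ true
kernelElement-leading j = trans (coeff-⊕ (s ^ₚ odd (double j)) (kernelElement-tail j) (topDegree j))
  (cong₂ _xor_ (s^-leading (odd (double j))) (vanishes (kernelElement-tail<topDegree j) (topDegree j) ≤-refl))

kernelElement-DegLt : ∀ j → DegLt (kernelElement j) (suc (topDegree j))
kernelElement-DegLt j = DegLt-⊕ (s^-DegLt (odd (double j))) (DegLt-mono (n≤1+n _) (kernelElement-tail<topDegree j))

kernelBasis : (m : ℕ) → Fin (suc m) → Poly
kernelBasis m       zero    = kernelElement m
kernelBasis (suc m) (suc i) = kernelBasis m i

kernelBasis-K : ∀ m i → InK m (kernelBasis m i)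
kernelBasis-K m       zero    = kernelElement-Lstar m , kernelElement-fixed m
kernelBasis-K (suc m) (suc i) = InK-suc {f = kernelBasis m i} (kernelBasis-K m i)

kernelBasis-DegLt : ∀ m i → DegLt (kernelBasis m i) (suc (topDegree m))
kernelBasis-DegLt m       zero    = kernelElement-DegLt m
kernelBasis-DegLt (suc m) (suc i) = DegLt-mono (m≤n⇒m≤1+n (topDegree-mono (n<1+n m))) (kernelBasis-DegLt m i)

kernelBasis-LinIndep : ∀ m → LinIndep (suc m) (kernelBasis m)
kernelBasis-LinIndep zero    = LinIndep-cons (topDegree 0) (kernelBasis 0) (kernelElement-leading 0) (λ ()) (λ _ _ ())
kernelBasis-LinIndep (suc m) = LinIndep-cons (topDegree (suc m)) (kernelBasis (suc m)) (kernelElement-leading (suc m))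
  (λ i → DegLt-mono (topDegree-mono (n<1+n m)) (kernelBasis-DegLt m i)) (kernelBasis-LinIndep m)

theorem2p9 : (m : ℕ) → DimKAtLeast m (suc m)
theorem2p9 m = kernelBasis m , kernelBasis-K m , kernelBasis-LinIndep m
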